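{- Let $k,c$ be positive integers with $k>6c$, and set $n=2k+c$ and $m=n-1$. Let $\mathcal F\in\mathcal C$, let $x$ be a vertex of maximum degree in $\mathcal F$, and define (identifying $V\setminus\{x\}$ with $[m]$) \[ \mathcal A=\mathcal F\setminus\mathcal K_x\subseteq\Gamma_k,\qquad \mathcal B=\{V\setminus T: T\in\mathcal K_x\setminus\mathcal F\}\subseteq\Gamma_{k+c},\qquad \bar{\mathcal B}=\Gamma_{k+c}\setminus\mathcal B. \] Then \[ \Lambda(\mathcal A,\bar{\mathcal B})\ \ge\ \max\left\{\frac{\beta_c(\mathcal A)}{2\binom{k}{c}},\ \frac{1}{2ck}\binom{k+c-2}{c-1}\beta_1(\mathcal A)\right\}-\frac12\binom{k+c-1}{c-1}|\mathcal A|. \]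
   Context: Write $V=[n]$, $\mathcal K=\binom{V}{k}$, $M=\binom{n-1}{k-1}$, and $\mathcal K_x=\{A\in\mathcal K:x\in A\}$ (a star). $\mathcal C$ is the collection of $M$-element subfamilies of $\mathcal K$ that are not stars. The degree of $x$ in $\mathcal F$ is $|\{A\in\mathcal F:x\in A\}|$. For an integer $l$, $\Gamma_l=\binom{[m]}{l}$ is the family of $l$-subsets of $[m]=V\setminus\{x\}$. For $\mathcal S\subseteq\Gamma_k$ and $\mathcal T\subseteq\Gamma_{k+c}$, define $\Lambda(\mathcal S,\mathcal T)=|\{(A,B)\in\mathcal S\times\mathcal T: A\subseteq B\}|$. For a positive integer $i$, $J_i(m,k)$ is the graph on $\Gamma_k$ in which $A,A'$ are adjacent iff $|A\,\triangle\, A'|=2i$. For $\mathcal A\subseteq\Gamma_k$, $\beta_i(\mathcal A)$ is the size of the edge boundary of $\mathcal A$ in $J_i(m,k)$, i.e. the number of edges $\{A,A'\}$ of $J_i(m,k)$ with $A\in\mathcal A$ and $A'\in\Gamma_k\setminus\mathcal A$. -}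

module Defs where

open import Data.Bool using (Bool; true; false; _∧_; not; if_then_else_)
open import Data.Nat using (ℕ; zero; suc; _+_; _*_; _∸_; _≤_; _≡ᵇ_)
open import Data.List using (List; []; _∷_; [_]; map; _++_; length; filterᵇ; concatMap)
open import Data.Vec using (Vec; []; _∷_; lookup; insertAt)
open import Data.Fin using (Fin)
open import Data.Fin.Subset using (Subset; ∣_∣; ∁)
open import Data.Nat.Combinatorics using (_C_)
open import Data.Product using (_×_)
open import Relation.Binary.PropositionalEquality using (_≡_)
open import Relation.Nullary using (¬_)

-- all subsets of Fin n (each exactly once), subsets as characteristic vectors
allSubsets : (n : ℕ) → List (Subset n)
allSubsets zero = [ [] ]
allSubsets (suc n) = map (true ∷_) (allSubsets n) ++ map (false ∷_) (allSubsets n)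

Family : ℕ → Set
Family n = Subset n → Bool

count : {n : ℕ} → (Subset n → Bool) → ℕ
count {n} P = length (filterᵇ P (allSubsets n))

size : {n : ℕ} → Family n → ℕ
size F = count F

Γ : {n : ℕ} → ℕ → Family n
Γ l S = ∣ S ∣ ≡ᵇ l

Star : {n : ℕ} → ℕ → Fin n → Family n
Star k x S = (∣ S ∣ ≡ᵇ k) ∧ lookup S x

degree : {n : ℕ} → Family n → Fin n → ℕ
degree F x = count (λ S → F S ∧ lookup S x)

Uniform : {n : ℕ} → ℕ → Family n → Set
Uniform k F = ∀ S → F S ≡ true → ∣ S ∣ ≡ k

-- F ∈ C : an M-element subfamily of K, M = binom(n-1,k-1), which is not a star
InC : (n k : ℕ) → Family n → Set
InC n k F = Uniform k F × (size F ≡ (n ∸ 1) C (k ∸ 1)) × (∀ x → ¬ (∀ S → F S ≡ Star k x S))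

MaxDegree : {n : ℕ} → Family n → Fin n → Set
MaxDegree F x = ∀ y → degree F y ≤ degree F x

-- identification of V \ {x} with [m]: a subset S' of Fin m corresponds to
-- the subset insertAt S' x false of V = Fin (suc m)

-- 𝒜 = F \ K_x, viewed inside [m]
𝒜 : {m : ℕ} → Family (suc m) → Fin (suc m) → Family m
𝒜 F x S' = F (insertAt S' x false)

-- ℬ = { V \ T : T ∈ K_x \ F }, viewed inside [m]:
-- S' ∈ ℬ iff T = V \ S' (complement in V) lies in K_x \ F
ℬ : {m : ℕ} → ℕ → Family (suc m) → Fin (suc m) → Family m
ℬ k F x S' = Star k x T ∧ not (F T)
  where T = ∁ (insertAt S' x false)

ℬ̄ : {m : ℕ} → ℕ → ℕ → Family (suc m) → Fin (suc m) → Family m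
ℬ̄ k c F x S' = Γ (k + c) S' ∧ not (ℬ k F x S')

_⊆ᵇ_ : {n : ℕ} → Subset n → Subset n → Bool
[] ⊆ᵇ [] = true
(true ∷ a) ⊆ᵇ (false ∷ b) = false
(_ ∷ a) ⊆ᵇ (_ ∷ b) = a ⊆ᵇ b

symDiff : {n : ℕ} → Subset n → Subset n → ℕ
symDiff [] [] = 0
symDiff (true ∷ a) (false ∷ b) = suc (symDiff a b)
symDiff (false ∷ a) (true ∷ b) = suc (symDiff a b)
symDiff (_ ∷ a) (_ ∷ b) = symDiff a b

countPairs : {n : ℕ} → (Subset n → Subset n → Bool) → ℕ
countPairs {n} R = length (concatMap (λ A → filterᵇ (R A) (allSubsets n)) (allSubsets n))

Λ : {n : ℕ} → Family n → Family n → ℕ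
Λ S T = countPairs (λ A B → S A ∧ T B ∧ (A ⊆ᵇ B))

-- β_i(𝒜): edge boundary of 𝒜 in J_i(m,k) (vertex set Γ_k, A ~ A' iff |A △ A'| = 2i).
-- Each boundary edge {A,A'} is counted once via the ordered pair with A ∈ 𝒜, A' ∉ 𝒜.
β : {m : ℕ} → ℕ → ℕ → Family m → ℕ
β k i 𝒜′ = countPairs (λ A A' → Γ k A ∧ 𝒜′ A ∧ Γ k A' ∧ not (𝒜′ A') ∧ (symDiff A A' ≡ᵇ 2 * i))

-- The proof is pure double counting over the Boolean lattice of [m].  The
-- module DoubleCounting then treats arbitrary P ⊆ Γ_k and Q ⊆ Γ_{k+c}: counting pairs
-- (B, boundary edge of P inside B) over B ∈ Γ_{k+c} and charging each pair to the end of
-- the edge in P (if B ∉ Q) or in Γ_k ∖ P (if B ∈ Q) bounds β_i(P) by Λ(P̄,Q) + Λ(P,Q̄);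
-- when |P| = |Q| two further countings give Λ(P̄,Q) = Λ(P,Q̄) + |P| (k+c-1 choose c-1).
-- Finally 𝒜 and ℬ are shown to be uniform of the right sizes with |𝒜| = |ℬ|, and the
-- theorem is the instance i = c and i = 1.
module Submission where

open import Defs
open import Data.Bool using (Bool; true; false; _∧_; not)
open import Data.Bool.Properties using (∧-zeroʳ; ∧-identityʳ; not-involutive; T-≡)
open import Data.Nat
open import Data.Nat.Properties
open import Data.Nat.Combinatorics
  using (_C_; nCk+nC[k+1]≡[n+1]C[k+1]; nCk≡nC[n∸k]; nCn≡1; nC1≡n; k>n⇒nCk≡0)
open import Data.Nat.Tactic.RingSolver using (solve-∀)
open import Algebra.Properties.CommutativeSemigroup +-commutativeSemigroup
  renaming (interchange to +-interchange)
open import Algebra.Properties.CommutativeSemigroup *-commutativeSemigroup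
  using () renaming (x∙yz≈y∙xz to *-exchange)
open import Data.List as List using (List; []; _∷_; filterᵇ; concatMap)
open import Data.Nat.ListAction using (sum)
open import Data.Nat.ListAction.Properties using (sum-++)
import Data.List.Properties as List
open import Data.Vec using ([]; _∷_; lookup; insertAt)
open import Data.Vec.Properties using (map-insertAt; insertAt-lookup; map-∘; map-cong; map-id)
open import Data.Fin using (Fin)
open import Data.Fin.Subset using (Subset; ∣_∣; ∁; _∪_; _─_; ⊤)
open import Data.Fin.Subset.Properties using (∣p∣≤n; ∣∁p∣≡n∸∣p∣; ∣⊤∣≡n)
open import Data.Product using (_×_; _,_; proj₁; proj₂)
open import Function using (_∘_; Equivalence)
open import Relation.Binary.PropositionalEquality
open import Relation.Nullary using (¬_)
open import Data.Empty using (⊥-elim)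

𝟙 : Bool → ℕ
𝟙 true = 1
𝟙 false = 0

𝟙-∧ : ∀ a b → 𝟙 (a ∧ b) ≡ 𝟙 a * 𝟙 b
𝟙-∧ true b = sym (+-identityʳ (𝟙 b))
𝟙-∧ false b = refl

𝟙-split : ∀ u {q g} → (q ≡ true → g ≡ true) → 𝟙 (u ∧ g) ≡ 𝟙 (u ∧ q) + 𝟙 (u ∧ (g ∧ not q))
𝟙-split false q⇒g = refl
𝟙-split true {true} q⇒g rewrite q⇒g refl = refl
𝟙-split true {false} {g} q⇒g = cong 𝟙 (sym (∧-identityʳ g))

∧-true⁻ : ∀ a {b} → a ∧ b ≡ true → a ≡ true × b ≡ true
∧-true⁻ true b≡true = refl , b≡true

≡ᵇ-sound : ∀ {m n} → (m ≡ᵇ n) ≡ true → m ≡ n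
≡ᵇ-sound {m} {n} h = ≡ᵇ⇒≡ m n (Equivalence.from T-≡ h)

≡ᵇ-complete : ∀ {m n} → m ≡ n → (m ≡ᵇ n) ≡ true
≡ᵇ-complete {m} {n} m≡n = Equivalence.to T-≡ (≡⇒≡ᵇ m n m≡n)

≡ᵇ-false : ∀ {m n} → ¬ m ≡ n → (m ≡ᵇ n) ≡ false
≡ᵇ-false {m} {n} m≢n with m ≡ᵇ n in eq
... | true = ⊥-elim (m≢n (≡ᵇ-sound eq))
... | false = refl

∑ : {n : ℕ} → (Subset n → ℕ) → ℕ
∑ {zero} f = f []
∑ {suc n} f = ∑ (λ S → f (true ∷ S)) + ∑ (λ S → f (false ∷ S))

infix 5 ∑
syntax ∑ (λ S → e) = ∑[ S ] e

∑-cong : ∀ {n} {f g : Subset n → ℕ} → (∀ S → f S ≡ g S) → ∑ f ≡ ∑ g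
∑-cong {zero} f≡g = f≡g []
∑-cong {suc n} f≡g = cong₂ _+_ (∑-cong (f≡g ∘ (true ∷_))) (∑-cong (f≡g ∘ (false ∷_)))

∑-zero : ∀ {n} → ∑ {n} (λ _ → 0) ≡ 0
∑-zero {zero} = refl
∑-zero {suc n} = cong₂ _+_ (∑-zero {n}) (∑-zero {n})

∑-vanish : ∀ {n} {f : Subset n → ℕ} → (∀ S → f S ≡ 0) → ∑ f ≡ 0
∑-vanish {n} f≡0 = trans (∑-cong f≡0) (∑-zero {n})

∑-+ : ∀ {n} (f g : Subset n → ℕ) → (∑[ S ] f S + g S) ≡ ∑ f + ∑ g
∑-+ {zero} f g = refl
∑-+ {suc n} f g =
  trans (cong₂ _+_ (∑-+ (f ∘ (true ∷_)) (g ∘ (true ∷_))) (∑-+ (f ∘ (false ∷_)) (g ∘ (false ∷_))))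
        (+-interchange (∑ (f ∘ (true ∷_))) (∑ (g ∘ (true ∷_))) (∑ (f ∘ (false ∷_))) (∑ (g ∘ (false ∷_))))

∑-*ˡ : ∀ {n} (a : ℕ) (f : Subset n → ℕ) → (∑[ S ] a * f S) ≡ a * ∑ f
∑-*ˡ {zero} a f = refl
∑-*ˡ {suc n} a f =
  trans (cong₂ _+_ (∑-*ˡ a (f ∘ (true ∷_))) (∑-*ˡ a (f ∘ (false ∷_)))) (sym (*-distribˡ-+ a _ _))

∑-*ʳ : ∀ {n} (a : ℕ) (f : Subset n → ℕ) → (∑[ S ] f S * a) ≡ ∑ f * a
∑-*ʳ a f = trans (∑-cong (λ S → *-comm (f S) a)) (trans (∑-*ˡ a f) (*-comm a (∑ f)))

∑-mono : ∀ {n} {f g : Subset n → ℕ} → (∀ S → f S ≤ g S) → ∑ f ≤ ∑ g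
∑-mono {zero} f≤g = f≤g []
∑-mono {suc n} f≤g = +-mono-≤ (∑-mono (f≤g ∘ (true ∷_))) (∑-mono (f≤g ∘ (false ∷_)))

∑-comm : ∀ {n p} (f : Subset n → Subset p → ℕ) → (∑[ A ] ∑[ B ] f A B) ≡ (∑[ B ] ∑[ A ] f A B)
∑-comm {zero} f = refl
∑-comm {suc n} f =
  trans (cong₂ _+_ (∑-comm (f ∘ (true ∷_))) (∑-comm (f ∘ (false ∷_))))
        (sym (∑-+ (λ B → ∑[ A ] f (true ∷ A) B) (λ B → ∑[ A ] f (false ∷ A) B)))

∑-weighted-comm : ∀ {n p} (w : Subset p → ℕ) (f : Subset n → Subset p → ℕ) →
                  (∑[ B ] w B * (∑[ A ] f A B)) ≡ (∑[ A ] ∑[ B ] w B * f A B)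
∑-weighted-comm w f = trans (∑-cong (λ B → sym (∑-*ˡ (w B) (λ A → f A B)))) (∑-comm (λ B A → w B * f A B))

∑-insertAt : ∀ {m} (x : Fin (suc m)) (f : Subset (suc m) → ℕ) →
             ∑ f ≡ (∑[ S ] f (insertAt S x true)) + (∑[ S ] f (insertAt S x false))
∑-insertAt Fin.zero f = refl
∑-insertAt {suc m} (Fin.suc x) f =
  trans (cong₂ _+_ (∑-insertAt x (f ∘ (true ∷_))) (∑-insertAt x (f ∘ (false ∷_))))
        (+-interchange (∑[ S ] f (true ∷ insertAt S x true)) (∑[ S ] f (true ∷ insertAt S x false))
                       (∑[ S ] f (false ∷ insertAt S x true)) (∑[ S ] f (false ∷ insertAt S x false)))

∑-∁ : ∀ {n} (f : Subset n → ℕ) → ∑ f ≡ (∑[ S ] f (∁ S))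
∑-∁ {zero} f = refl
∑-∁ {suc n} f = trans (cong₂ _+_ (∑-∁ (f ∘ (true ∷_))) (∑-∁ (f ∘ (false ∷_)))) (+-comm (∑[ S ] f (true ∷ ∁ S)) _)

sum-allSubsets : ∀ n (f : Subset n → ℕ) → sum (List.map f (allSubsets n)) ≡ ∑ f
sum-allSubsets zero f = +-identityʳ (f [])
sum-allSubsets (suc n) f = begin
  sum (List.map f (List.map (true ∷_) L List.++ List.map (false ∷_) L))
    ≡⟨ cong sum (List.map-++ f (List.map (true ∷_) L) _) ⟩
  sum (List.map f (List.map (true ∷_) L) List.++ List.map f (List.map (false ∷_) L))
    ≡⟨ sum-++ (List.map f (List.map (true ∷_) L)) _ ⟩
  sum (List.map f (List.map (true ∷_) L)) + sum (List.map f (List.map (false ∷_) L))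
    ≡⟨ cong₂ (λ u v → sum u + sum v) (sym (List.map-∘ L)) (sym (List.map-∘ L)) ⟩
  sum (List.map (f ∘ (true ∷_)) L) + sum (List.map (f ∘ (false ∷_)) L)
    ≡⟨ cong₂ _+_ (sum-allSubsets n (f ∘ (true ∷_))) (sum-allSubsets n (f ∘ (false ∷_))) ⟩
  ∑ f ∎
  where
  open ≡-Reasoning
  L : List (Subset n)
  L = allSubsets n

length-filterᵇ : ∀ {A : Set} (P : A → Bool) xs → List.length (filterᵇ P xs) ≡ sum (List.map (𝟙 ∘ P) xs)
length-filterᵇ P [] = refl
length-filterᵇ P (x ∷ xs) with P x
... | true = cong suc (length-filterᵇ P xs)
... | false = length-filterᵇ P xs

length-concatMap : ∀ {A B : Set} (g : A → List B) xs →
                   List.length (concatMap g xs) ≡ sum (List.map (List.length ∘ g) xs)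
length-concatMap g [] = refl
length-concatMap g (x ∷ xs) = trans (List.length-++ (g x)) (cong (List.length (g x) +_) (length-concatMap g xs))

count≡∑ : ∀ {n} (P : Subset n → Bool) → count P ≡ (∑[ S ] 𝟙 (P S))
count≡∑ {n} P = trans (length-filterᵇ P (allSubsets n)) (sum-allSubsets n (𝟙 ∘ P))

countPairs≡∑ : ∀ {n} (R : Subset n → Subset n → Bool) → countPairs R ≡ (∑[ A ] ∑[ B ] 𝟙 (R A B))
countPairs≡∑ {n} R =
  trans (length-concatMap (λ A → filterᵇ (R A) (allSubsets n)) (allSubsets n))
        (trans (sum-allSubsets n _) (∑-cong (λ A → count≡∑ (R A))))

symDiff-split : ∀ {n} (A B : Subset n) → symDiff A B ≡ ∣ A ─ B ∣ + ∣ B ─ A ∣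
symDiff-split [] [] = refl
symDiff-split (true ∷ A) (true ∷ B) = symDiff-split A B
symDiff-split (true ∷ A) (false ∷ B) = cong suc (symDiff-split A B)
symDiff-split (false ∷ A) (true ∷ B) = trans (cong suc (symDiff-split A B)) (sym (+-suc ∣ A ─ B ∣ _))
symDiff-split (false ∷ A) (false ∷ B) = symDiff-split A B

symDiff-comm : ∀ {n} (A B : Subset n) → symDiff A B ≡ symDiff B A
symDiff-comm A B = trans (symDiff-split A B) (trans (+-comm ∣ A ─ B ∣ _) (sym (symDiff-split B A)))

-- both sides count A ∪ B
card-balance : ∀ {n} (A B : Subset n) → ∣ A ∣ + ∣ B ─ A ∣ ≡ ∣ B ∣ + ∣ A ─ B ∣
card-balance [] [] = refl
card-balance (true ∷ A) (true ∷ B) = cong suc (card-balance A B)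
card-balance (true ∷ A) (false ∷ B) = trans (cong suc (card-balance A B)) (sym (+-suc ∣ B ∣ _))
card-balance (false ∷ A) (true ∷ B) = trans (+-suc ∣ A ∣ _) (cong suc (card-balance A B))
card-balance (false ∷ A) (false ∷ B) = card-balance A B

card-∪ : ∀ {n} (A B : Subset n) → ∣ A ∪ B ∣ ≡ ∣ A ∣ + ∣ B ─ A ∣
card-∪ [] [] = refl
card-∪ (true ∷ A) (true ∷ B) = cong suc (card-∪ A B)
card-∪ (true ∷ A) (false ∷ B) = cong suc (card-∪ A B)
card-∪ (false ∷ A) (true ∷ B) = trans (cong suc (card-∪ A B)) (sym (+-suc ∣ A ∣ _))
card-∪ (false ∷ A) (false ∷ B) = card-∪ A B

∪-⊆ᵇ : ∀ {n} (A B C : Subset n) → (A ∪ B) ⊆ᵇ C ≡ (A ⊆ᵇ C) ∧ (B ⊆ᵇ C)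
∪-⊆ᵇ [] [] [] = refl
∪-⊆ᵇ (true ∷ A) (true ∷ B) (true ∷ C) = ∪-⊆ᵇ A B C
∪-⊆ᵇ (true ∷ A) (true ∷ B) (false ∷ C) = refl
∪-⊆ᵇ (true ∷ A) (false ∷ B) (true ∷ C) = ∪-⊆ᵇ A B C
∪-⊆ᵇ (true ∷ A) (false ∷ B) (false ∷ C) = refl
∪-⊆ᵇ (false ∷ A) (true ∷ B) (true ∷ C) = ∪-⊆ᵇ A B C
∪-⊆ᵇ (false ∷ A) (true ∷ B) (false ∷ C) = sym (∧-zeroʳ (A ⊆ᵇ C))
∪-⊆ᵇ (false ∷ A) (false ∷ B) (true ∷ C) = ∪-⊆ᵇ A B C
∪-⊆ᵇ (false ∷ A) (false ∷ B) (false ∷ C) = ∪-⊆ᵇ A B C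

⊆ᵇ⇒─-empty : ∀ {n} (A B : Subset n) → A ⊆ᵇ B ≡ true → ∣ A ─ B ∣ ≡ 0
⊆ᵇ⇒─-empty [] [] A⊆B = refl
⊆ᵇ⇒─-empty (true ∷ A) (true ∷ B) A⊆B = ⊆ᵇ⇒─-empty A B A⊆B
⊆ᵇ⇒─-empty (false ∷ A) (true ∷ B) A⊆B = ⊆ᵇ⇒─-empty A B A⊆B
⊆ᵇ⇒─-empty (false ∷ A) (false ∷ B) A⊆B = ⊆ᵇ⇒─-empty A B A⊆B

card-⊆ᵇ : ∀ {n} (A B : Subset n) → A ⊆ᵇ B ≡ true → ∣ A ∣ + ∣ B ─ A ∣ ≡ ∣ B ∣
card-⊆ᵇ A B A⊆B = trans (card-balance A B) (trans (cong (∣ B ∣ +_) (⊆ᵇ⇒─-empty A B A⊆B)) (+-identityʳ ∣ B ∣))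

⊆ᵇ⇒≤ : ∀ {n} (A B : Subset n) → A ⊆ᵇ B ≡ true → ∣ A ∣ ≤ ∣ B ∣
⊆ᵇ⇒≤ A B A⊆B = ≤-trans (m≤m+n ∣ A ∣ _) (≤-reflexive (card-⊆ᵇ A B A⊆B))

⊆ᵇ-⊤ : ∀ {n} (S : Subset n) → S ⊆ᵇ ⊤ ≡ true
⊆ᵇ-⊤ [] = refl
⊆ᵇ-⊤ (true ∷ S) = ⊆ᵇ-⊤ S
⊆ᵇ-⊤ (false ∷ S) = ⊆ᵇ-⊤ S

johnson-adjacency : ∀ {n k} i (A A' : Subset n) → ∣ A ∣ ≡ k →
  (Γ k A' ∧ (symDiff A A' ≡ᵇ 2 * i)) ≡ ((∣ A ─ A' ∣ ≡ᵇ i) ∧ (∣ A' ─ A ∣ ≡ᵇ i))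
johnson-adjacency {k = k} i A A' ∣A∣≡k = bool-ext adjacent⇒ ⇒adjacent
  where
  bool-ext : ∀ {a b} → (a ≡ true → b ≡ true) → (b ≡ true → a ≡ true) → a ≡ b
  bool-ext {true} a⇒b b⇒a = sym (a⇒b refl)
  bool-ext {false} {true} a⇒b b⇒a = b⇒a refl
  bool-ext {false} {false} a⇒b b⇒a = refl
  double : ∀ d → d + d ≡ 2 * d
  double d = cong (d +_) (sym (+-identityʳ d))
  adjacent⇒ : (Γ k A' ∧ (symDiff A A' ≡ᵇ 2 * i)) ≡ true → ((∣ A ─ A' ∣ ≡ᵇ i) ∧ (∣ A' ─ A ∣ ≡ᵇ i)) ≡ true
  adjacent⇒ h with ∧-true⁻ (Γ k A') h
  ... | ∣A'∣≡k , sd≡2i = cong₂ _∧_ (≡ᵇ-complete out≡i) (≡ᵇ-complete (trans in≡out out≡i))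
    where
    in≡out : ∣ A' ─ A ∣ ≡ ∣ A ─ A' ∣
    in≡out = +-cancelˡ-≡ k ∣ A' ─ A ∣ ∣ A ─ A' ∣ (begin
      k + ∣ A' ─ A ∣        ≡⟨ cong (_+ ∣ A' ─ A ∣) (sym ∣A∣≡k) ⟩
      ∣ A ∣ + ∣ A' ─ A ∣    ≡⟨ card-balance A A' ⟩
      ∣ A' ∣ + ∣ A ─ A' ∣   ≡⟨ cong (_+ ∣ A ─ A' ∣) (≡ᵇ-sound ∣A'∣≡k) ⟩
      k + ∣ A ─ A' ∣        ∎)
      where open ≡-Reasoning
    out≡i : ∣ A ─ A' ∣ ≡ i
    out≡i = *-cancelˡ-≡ ∣ A ─ A' ∣ i 2 (begin
      2 * ∣ A ─ A' ∣                ≡⟨ sym (double ∣ A ─ A' ∣) ⟩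
      ∣ A ─ A' ∣ + ∣ A ─ A' ∣       ≡⟨ cong (∣ A ─ A' ∣ +_) (sym in≡out) ⟩
      ∣ A ─ A' ∣ + ∣ A' ─ A ∣       ≡⟨ sym (symDiff-split A A') ⟩
      symDiff A A'                  ≡⟨ ≡ᵇ-sound sd≡2i ⟩
      2 * i                         ∎)
      where open ≡-Reasoning
  ⇒adjacent : ((∣ A ─ A' ∣ ≡ᵇ i) ∧ (∣ A' ─ A ∣ ≡ᵇ i)) ≡ true → (Γ k A' ∧ (symDiff A A' ≡ᵇ 2 * i)) ≡ true
  ⇒adjacent h with ∧-true⁻ (∣ A ─ A' ∣ ≡ᵇ i) h
  ... | out≡ᵇi , in≡ᵇi = cong₂ _∧_ (≡ᵇ-complete ∣A'∣≡k) (≡ᵇ-complete sd≡2i)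
    where
    out≡i : ∣ A ─ A' ∣ ≡ i
    out≡i = ≡ᵇ-sound out≡ᵇi
    in≡i : ∣ A' ─ A ∣ ≡ i
    in≡i = ≡ᵇ-sound in≡ᵇi
    ∣A'∣≡k : ∣ A' ∣ ≡ k
    ∣A'∣≡k = trans (+-cancelʳ-≡ i ∣ A' ∣ ∣ A ∣ (begin
      ∣ A' ∣ + i            ≡⟨ cong (∣ A' ∣ +_) (sym out≡i) ⟩
      ∣ A' ∣ + ∣ A ─ A' ∣   ≡⟨ sym (card-balance A A') ⟩
      ∣ A ∣ + ∣ A' ─ A ∣    ≡⟨ cong (∣ A ∣ +_) in≡i ⟩
      ∣ A ∣ + i             ∎)) ∣A∣≡k
      where open ≡-Reasoning
    sd≡2i : symDiff A A' ≡ 2 * i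
    sd≡2i = trans (symDiff-split A A') (trans (cong₂ _+_ out≡i in≡i) (double i))

C-zero : ∀ n → n C 0 ≡ 1
C-zero n = trans (nCk≡nC[n∸k] {0} {n} z≤n) (nCn≡1 n)

C-zero-irrelevant : ∀ a b → a C 0 ≡ b C 0
C-zero-irrelevant a b = trans (C-zero a) (sym (C-zero b))

C-of-zero : ∀ j → 𝟙 (0 ≡ᵇ j) ≡ 0 C j
C-of-zero zero = sym (C-zero 0)
C-of-zero (suc j) = sym (k>n⇒nCk≡0 {0} {suc j} (s≤s z≤n))

pascal : ∀ n k → suc n C suc k ≡ n C k + n C suc k
pascal n k = sym (nCk+nC[k+1]≡[n+1]C[k+1] n k)

layer-pascal : ∀ k c → 1 ≤ c → (k + c) C k ≡ (k + c ∸ 1) C (c ∸ 1) + (k + c ∸ 1) C c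
layer-pascal k (suc c) _ = begin
  (k + suc c) C k               ≡⟨ nCk≡nC[n∸k] (m≤m+n k (suc c)) ⟩
  (k + suc c) C (k + suc c ∸ k) ≡⟨ cong ((k + suc c) C_) (m+n∸m≡n k (suc c)) ⟩
  (k + suc c) C suc c           ≡⟨ cong (_C suc c) (+-suc k c) ⟩
  suc (k + c) C suc c           ≡⟨ pascal (k + c) c ⟩
  (k + c) C c + (k + c) C suc c ≡⟨ cong (λ l → l C c + l C suc c) (sym k+c≡) ⟩
  (k + suc c ∸ 1) C c + (k + suc c ∸ 1) C suc c ∎
  where
  open ≡-Reasoning
  k+c≡ : k + suc c ∸ 1 ≡ k + c
  k+c≡ = cong (_∸ 1) (+-suc k c)

inside : ∀ {n} → Family n → Subset n → ℕ
inside S B = ∑[ A ] 𝟙 ((A ⊆ᵇ B) ∧ S A)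

subsets-of-size : ∀ {n} j (B : Subset n) → inside (Γ j) B ≡ ∣ B ∣ C j
subsets-of-size j [] = C-of-zero j
subsets-of-size {suc n} zero (true ∷ B) =
  trans (cong₂ _+_ (∑-vanish (λ A → cong 𝟙 (∧-zeroʳ (A ⊆ᵇ B)))) (subsets-of-size 0 B))
        (C-zero-irrelevant ∣ B ∣ (suc ∣ B ∣))
subsets-of-size (suc j) (true ∷ B) =
  trans (cong₂ _+_ (subsets-of-size j B) (subsets-of-size (suc j) B)) (sym (pascal ∣ B ∣ j))
subsets-of-size {suc n} j (false ∷ B) = cong₂ _+_ (∑-zero {n}) (subsets-of-size j B)

supersets-of-size : ∀ {n} j (U : Subset n) → (∑[ B ] 𝟙 ((U ⊆ᵇ B) ∧ Γ (∣ U ∣ + j) B)) ≡ (n ∸ ∣ U ∣) C j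
supersets-of-size j [] = C-of-zero j
supersets-of-size {suc n} j (true ∷ U) =
  trans (cong₂ _+_ (supersets-of-size j U) (∑-zero {n})) (+-identityʳ _)
supersets-of-size {suc n} zero (false ∷ U) =
  trans (cong₂ _+_ (∑-vanish too-large) (supersets-of-size 0 U))
        (C-zero-irrelevant (n ∸ ∣ U ∣) (suc n ∸ ∣ U ∣))
  where
  too-large : ∀ B → 𝟙 ((U ⊆ᵇ B) ∧ (suc ∣ B ∣ ≡ᵇ ∣ U ∣ + 0)) ≡ 0
  too-large B with U ⊆ᵇ B in U⊆B
  ... | true = cong 𝟙 (≡ᵇ-false (λ e → 1+n≰n (≤-trans (≤-reflexive (trans e (+-identityʳ ∣ U ∣))) (⊆ᵇ⇒≤ U B U⊆B))))
  ... | false = refl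
supersets-of-size {suc n} (suc j) (false ∷ U) = begin
  (∑[ B ] 𝟙 ((U ⊆ᵇ B) ∧ (suc ∣ B ∣ ≡ᵇ ∣ U ∣ + suc j))) + (∑[ B ] 𝟙 ((U ⊆ᵇ B) ∧ Γ (∣ U ∣ + suc j) B))
    ≡⟨ cong₂ _+_ (trans (∑-cong (λ B → cong (λ l → 𝟙 ((U ⊆ᵇ B) ∧ (suc ∣ B ∣ ≡ᵇ l))) (+-suc ∣ U ∣ j)))
                        (supersets-of-size j U))
                 (supersets-of-size (suc j) U) ⟩
  (n ∸ ∣ U ∣) C j + (n ∸ ∣ U ∣) C suc j
    ≡⟨ sym (pascal (n ∸ ∣ U ∣) j) ⟩
  suc (n ∸ ∣ U ∣) C suc j
    ≡⟨ cong (_C suc j) (sym (+-∸-assoc 1 (∣p∣≤n U))) ⟩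
  (suc n ∸ ∣ U ∣) C suc j ∎
  where open ≡-Reasoning

exchanges-within : ∀ {n} (A B : Subset n) → A ⊆ᵇ B ≡ true → ∀ r s →
  (∑[ A' ] 𝟙 ((A' ⊆ᵇ B) ∧ ((∣ A ─ A' ∣ ≡ᵇ r) ∧ (∣ A' ─ A ∣ ≡ᵇ s)))) ≡ (∣ A ∣ C r) * (∣ B ─ A ∣ C s)
exchanges-within [] [] _ r s = trans (𝟙-∧ (0 ≡ᵇ r) (0 ≡ᵇ s)) (cong₂ _*_ (C-of-zero r) (C-of-zero s))
exchanges-within (true ∷ A) (true ∷ B) A⊆B zero s =
  trans (cong₂ _+_ (exchanges-within A B A⊆B zero s) (∑-vanish (λ A' → cong 𝟙 (∧-zeroʳ (A' ⊆ᵇ B)))))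
        (trans (+-identityʳ _) (cong (_* (∣ B ─ A ∣ C s)) (C-zero-irrelevant ∣ A ∣ (suc ∣ A ∣))))
exchanges-within (true ∷ A) (true ∷ B) A⊆B (suc r) s =
  trans (cong₂ _+_ (exchanges-within A B A⊆B (suc r) s) (exchanges-within A B A⊆B r s)) (begin
  (∣ A ∣ C suc r) * (∣ B ─ A ∣ C s) + (∣ A ∣ C r) * (∣ B ─ A ∣ C s)
    ≡⟨ +-comm ((∣ A ∣ C suc r) * (∣ B ─ A ∣ C s)) _ ⟩
  (∣ A ∣ C r) * (∣ B ─ A ∣ C s) + (∣ A ∣ C suc r) * (∣ B ─ A ∣ C s)
    ≡⟨ sym (*-distribʳ-+ (∣ B ─ A ∣ C s) (∣ A ∣ C r) (∣ A ∣ C suc r)) ⟩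
  (∣ A ∣ C r + ∣ A ∣ C suc r) * (∣ B ─ A ∣ C s)
    ≡⟨ cong (_* (∣ B ─ A ∣ C s)) (sym (pascal ∣ A ∣ r)) ⟩
  (suc ∣ A ∣ C suc r) * (∣ B ─ A ∣ C s) ∎)
  where open ≡-Reasoning
exchanges-within (false ∷ A) (true ∷ B) A⊆B r zero =
  trans (cong (_+ (∑[ A' ] 𝟙 ((A' ⊆ᵇ B) ∧ ((∣ A ─ A' ∣ ≡ᵇ r) ∧ (∣ A' ─ A ∣ ≡ᵇ zero)))))
              (∑-vanish (λ A' → trans (cong (λ b → 𝟙 ((A' ⊆ᵇ B) ∧ b)) (∧-zeroʳ (∣ A ─ A' ∣ ≡ᵇ r)))
                                              (cong 𝟙 (∧-zeroʳ (A' ⊆ᵇ B))))))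
        (trans (exchanges-within A B A⊆B r zero) (cong ((∣ A ∣ C r) *_) (C-zero-irrelevant ∣ B ─ A ∣ (suc ∣ B ─ A ∣))))
exchanges-within (false ∷ A) (true ∷ B) A⊆B r (suc s) =
  trans (cong₂ _+_ (exchanges-within A B A⊆B r s) (exchanges-within A B A⊆B r (suc s)))
        (trans (sym (*-distribˡ-+ (∣ A ∣ C r) _ _)) (cong ((∣ A ∣ C r) *_) (sym (pascal ∣ B ─ A ∣ s))))
exchanges-within {suc n} (false ∷ A) (false ∷ B) A⊆B r s = cong₂ _+_ (∑-zero {n}) (exchanges-within A B A⊆B r s)

J-neighbours : ∀ {n} → ℕ → ℕ → Subset n → Family n
J-neighbours k i A A' = Γ k A' ∧ (symDiff A A' ≡ᵇ 2 * i)

J-neighbours-within : ∀ {n k c} i (A B : Subset n) → ∣ A ∣ ≡ k → A ⊆ᵇ B ≡ true → ∣ B ∣ ≡ k + c →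
  inside (J-neighbours k i A) B ≡ (k C i) * (c C i)
J-neighbours-within {k = k} {c} i A B ∣A∣≡k A⊆B ∣B∣≡k+c = begin
  inside (J-neighbours k i A) B
    ≡⟨ ∑-cong (λ A' → cong (λ b → 𝟙 ((A' ⊆ᵇ B) ∧ b)) (johnson-adjacency i A A' ∣A∣≡k)) ⟩
  (∑[ A' ] 𝟙 ((A' ⊆ᵇ B) ∧ ((∣ A ─ A' ∣ ≡ᵇ i) ∧ (∣ A' ─ A ∣ ≡ᵇ i))))
    ≡⟨ exchanges-within A B A⊆B i i ⟩
  (∣ A ∣ C i) * (∣ B ─ A ∣ C i)
    ≡⟨ cong₂ (λ a d → (a C i) * (d C i)) ∣A∣≡k ∣B─A∣≡c ⟩
  (k C i) * (c C i) ∎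
  where
  open ≡-Reasoning
  ∣B─A∣≡c : ∣ B ─ A ∣ ≡ c
  ∣B─A∣≡c = +-cancelˡ-≡ k ∣ B ─ A ∣ c
    (trans (cong (_+ ∣ B ─ A ∣) (sym ∣A∣≡k)) (trans (card-⊆ᵇ A B A⊆B) ∣B∣≡k+c))

J-adjacent-union : ∀ {n k} i (A A' : Subset n) → ∣ A ∣ ≡ k → J-neighbours k i A A' ≡ true → ∣ A ∪ A' ∣ ≡ k + i
J-adjacent-union i A A' ∣A∣≡k adjacent =
  trans (card-∪ A A') (cong₂ _+_ ∣A∣≡k (≡ᵇ-sound (proj₂ (∧-true⁻ (∣ A ─ A' ∣ ≡ᵇ i) exchange))))
  where
  exchange : ((∣ A ─ A' ∣ ≡ᵇ i) ∧ (∣ A' ─ A ∣ ≡ᵇ i)) ≡ true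
  exchange = trans (sym (johnson-adjacency i A A' ∣A∣≡k)) adjacent

Λ-as-sum : ∀ {n} (S T : Family n) → Λ S T ≡ (∑[ B ] 𝟙 (T B) * inside S B)
Λ-as-sum S T = begin
  Λ S T                                              ≡⟨ countPairs≡∑ (λ A B → S A ∧ T B ∧ (A ⊆ᵇ B)) ⟩
  (∑[ A ] ∑[ B ] 𝟙 (S A ∧ T B ∧ (A ⊆ᵇ B)))            ≡⟨ ∑-cong (λ A → ∑-cong (λ B → rearrange (S A) (T B) (A ⊆ᵇ B))) ⟩
  (∑[ A ] ∑[ B ] 𝟙 (T B) * 𝟙 ((A ⊆ᵇ B) ∧ S A))        ≡⟨ sym (∑-weighted-comm (𝟙 ∘ T) (λ A B → 𝟙 ((A ⊆ᵇ B) ∧ S A))) ⟩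
  (∑[ B ] 𝟙 (T B) * inside S B)                       ∎
  where
  open ≡-Reasoning
  rearrange : ∀ s t u → 𝟙 (s ∧ t ∧ u) ≡ 𝟙 t * 𝟙 (u ∧ s)
  rearrange false false u = refl
  rearrange false true false = refl
  rearrange false true true = refl
  rearrange true false u = refl
  rearrange true true false = refl
  rearrange true true true = refl

𝟙-guarded-≤ : ∀ b {x y} → (b ≡ true → x ≤ y) → 𝟙 b * x ≤ 𝟙 b * y
𝟙-guarded-≤ true x≤y = *-monoʳ-≤ 1 (x≤y refl)
𝟙-guarded-≤ false x≤y = z≤n

-- an edge of J_i leaving P, inside B, puts its inner end in P ∩ 2^B and its outer end
-- among the J_i-neighbours of the inner end inside B (and symmetrically)
edge⇒inner : ∀ a p a' p' s u v → 𝟙 (a ∧ p ∧ a' ∧ not p' ∧ s) * 𝟙 (u ∧ v) ≤ 𝟙 (u ∧ p) * 𝟙 (v ∧ (a' ∧ s))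
edge⇒inner false _ _ _ _ _ _ = z≤n
edge⇒inner true false _ _ _ _ _ = z≤n
edge⇒inner true true false _ _ _ _ = z≤n
edge⇒inner true true true true _ _ _ = z≤n
edge⇒inner true true true false false _ _ = z≤n
edge⇒inner true true true false true false _ = z≤n
edge⇒inner true true true false true true false = z≤n
edge⇒inner true true true false true true true = ≤-refl

edge⇒outer : ∀ a p a' p' s u v → 𝟙 (a ∧ p ∧ a' ∧ not p' ∧ s) * 𝟙 (u ∧ v) ≤ 𝟙 (v ∧ (a' ∧ not p')) * 𝟙 (u ∧ (a ∧ s))
edge⇒outer false _ _ _ _ _ _ = z≤n
edge⇒outer true false _ _ _ _ _ = z≤n
edge⇒outer true true false _ _ _ _ = z≤n
edge⇒outer true true true true _ _ _ = z≤n
edge⇒outer true true true false false _ _ = z≤n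
edge⇒outer true true true false true false _ = z≤n
edge⇒outer true true true false true true false = z≤n
edge⇒outer true true true false true true true = ≤-refl

neighbour-pairs-within : ∀ {n} k c i (S : Family n) → (∀ A → S A ≡ true → ∣ A ∣ ≡ k) →
  ∀ B → ∣ B ∣ ≡ k + c →
  (∑[ A ] 𝟙 ((A ⊆ᵇ B) ∧ S A) * inside (J-neighbours k i A) B) ≡ ((k C i) * (c C i)) * inside S B
neighbour-pairs-within k c i S S-uniform B ∣B∣≡k+c =
  trans (∑-cong neighbours) (trans (∑-*ʳ N (λ A → 𝟙 ((A ⊆ᵇ B) ∧ S A))) (*-comm (inside S B) N))
  where
  N : ℕ
  N = (k C i) * (c C i)
  neighbours : ∀ A → 𝟙 ((A ⊆ᵇ B) ∧ S A) * inside (J-neighbours k i A) B ≡ 𝟙 ((A ⊆ᵇ B) ∧ S A) * N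
  neighbours A with (A ⊆ᵇ B) ∧ S A in A∈S∩2ᴮ
  ... | false = refl
  ... | true with ∧-true⁻ (A ⊆ᵇ B) A∈S∩2ᴮ
  ...   | A⊆B , A∈S = cong (1 *_) (J-neighbours-within i A B (S-uniform A A∈S) A⊆B ∣B∣≡k+c)

module DoubleCounting {m : ℕ} (k c : ℕ) (P Q : Family m)
  (P-uniform : ∀ A → P A ≡ true → ∣ A ∣ ≡ k)
  (Q-uniform : ∀ B → Q B ≡ true → ∣ B ∣ ≡ k + c) where

  P̄ : Family m
  P̄ A = Γ k A ∧ not (P A)

  Q̄ : Family m
  Q̄ B = Γ (k + c) B ∧ not (Q B)

  P̄-uniform : ∀ A → P̄ A ≡ true → ∣ A ∣ ≡ k
  P̄-uniform A h = ≡ᵇ-sound (proj₁ (∧-true⁻ (Γ k A) h))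

  Γ-split : ∀ B → 𝟙 (Γ (k + c) B) ≡ 𝟙 (Q B) + 𝟙 (Q̄ B)
  Γ-split B = 𝟙-split true (λ h → ≡ᵇ-complete (Q-uniform B h))

  ∑-Γ-split : (f : Subset m → ℕ) → (∑[ B ] 𝟙 (Γ (k + c) B) * f B) ≡ (∑[ B ] 𝟙 (Q B) * f B) + (∑[ B ] 𝟙 (Q̄ B) * f B)
  ∑-Γ-split f = trans (∑-cong (λ B → trans (cong (_* f B) (Γ-split B)) (*-distribʳ-+ (f B) (𝟙 (Q B)) _)))
                      (∑-+ (λ B → 𝟙 (Q B) * f B) (λ B → 𝟙 (Q̄ B) * f B))

  -- every A ∈ P lies in ((m - k) choose c) members of Γ_{k+c}
  Λ-P-layer : Λ P Q + Λ P Q̄ ≡ size P * ((m ∸ k) C c)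
  Λ-P-layer = begin
    Λ P Q + Λ P Q̄
      ≡⟨ cong₂ _+_ (Λ-as-sum P Q) (Λ-as-sum P Q̄) ⟩
    (∑[ B ] 𝟙 (Q B) * inside P B) + (∑[ B ] 𝟙 (Q̄ B) * inside P B)
      ≡⟨ sym (∑-Γ-split (inside P)) ⟩
    (∑[ B ] 𝟙 (Γ (k + c) B) * inside P B)
      ≡⟨ ∑-weighted-comm (𝟙 ∘ Γ (k + c)) (λ A B → 𝟙 ((A ⊆ᵇ B) ∧ P A)) ⟩
    (∑[ A ] ∑[ B ] 𝟙 (Γ (k + c) B) * 𝟙 ((A ⊆ᵇ B) ∧ P A))
      ≡⟨ ∑-cong supersets-in-layer ⟩
    (∑[ A ] 𝟙 (P A) * ((m ∸ k) C c))
      ≡⟨ trans (∑-*ʳ ((m ∸ k) C c) (𝟙 ∘ P)) (cong (_* ((m ∸ k) C c)) (sym (count≡∑ P))) ⟩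
    size P * ((m ∸ k) C c) ∎
    where
    open ≡-Reasoning
    supersets-in-layer : ∀ A → (∑[ B ] 𝟙 (Γ (k + c) B) * 𝟙 ((A ⊆ᵇ B) ∧ P A)) ≡ 𝟙 (P A) * ((m ∸ k) C c)
    supersets-in-layer A with P A in PA
    ... | false = ∑-vanish (λ B → trans (cong (𝟙 (Γ (k + c) B) *_) (cong 𝟙 (∧-zeroʳ (A ⊆ᵇ B)))) (*-zeroʳ (𝟙 (Γ (k + c) B))))
    ... | true = begin
      (∑[ B ] 𝟙 (Γ (k + c) B) * 𝟙 ((A ⊆ᵇ B) ∧ true))
        ≡⟨ ∑-cong (λ B → trans (cong (𝟙 (Γ (k + c) B) *_) (cong 𝟙 (∧-identityʳ (A ⊆ᵇ B))))
                         (trans (*-comm (𝟙 (Γ (k + c) B)) _) (sym (𝟙-∧ (A ⊆ᵇ B) _)))) ⟩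
      (∑[ B ] 𝟙 ((A ⊆ᵇ B) ∧ Γ (k + c) B))
        ≡⟨ ∑-cong (λ B → cong (λ l → 𝟙 ((A ⊆ᵇ B) ∧ Γ (l + c) B)) (sym ∣A∣≡k)) ⟩
      (∑[ B ] 𝟙 ((A ⊆ᵇ B) ∧ Γ (∣ A ∣ + c) B))
        ≡⟨ supersets-of-size c A ⟩
      (m ∸ ∣ A ∣) C c
        ≡⟨ cong (λ l → (m ∸ l) C c) ∣A∣≡k ⟩
      (m ∸ k) C c
        ≡⟨ sym (+-identityʳ _) ⟩
      1 * ((m ∸ k) C c) ∎
      where
      ∣A∣≡k : ∣ A ∣ ≡ k
      ∣A∣≡k = P-uniform A PA

  -- every B ∈ Q contains ((k + c) choose k) members of Γ_k
  Λ-into-Q : Λ P Q + Λ P̄ Q ≡ size Q * ((k + c) C k)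
  Λ-into-Q = begin
    Λ P Q + Λ P̄ Q
      ≡⟨ cong₂ _+_ (Λ-as-sum P Q) (Λ-as-sum P̄ Q) ⟩
    (∑[ B ] 𝟙 (Q B) * inside P B) + (∑[ B ] 𝟙 (Q B) * inside P̄ B)
      ≡⟨ sym (∑-+ (λ B → 𝟙 (Q B) * inside P B) (λ B → 𝟙 (Q B) * inside P̄ B)) ⟩
    (∑[ B ] 𝟙 (Q B) * inside P B + 𝟙 (Q B) * inside P̄ B)
      ≡⟨ ∑-cong (λ B → trans (sym (*-distribˡ-+ (𝟙 (Q B)) _ _)) (cong (𝟙 (Q B) *_) (inside-split B))) ⟩
    (∑[ B ] 𝟙 (Q B) * inside (Γ k) B)
      ≡⟨ ∑-cong k-subsets ⟩
    (∑[ B ] 𝟙 (Q B) * ((k + c) C k))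
      ≡⟨ trans (∑-*ʳ ((k + c) C k) (𝟙 ∘ Q)) (cong (_* ((k + c) C k)) (sym (count≡∑ Q))) ⟩
    size Q * ((k + c) C k) ∎
    where
    open ≡-Reasoning
    inside-split : ∀ B → inside P B + inside P̄ B ≡ inside (Γ k) B
    inside-split B = sym (trans (∑-cong (λ A → 𝟙-split (A ⊆ᵇ B) (λ h → ≡ᵇ-complete (P-uniform A h))))
                                (∑-+ (λ A → 𝟙 ((A ⊆ᵇ B) ∧ P A)) (λ A → 𝟙 ((A ⊆ᵇ B) ∧ P̄ A))))
    k-subsets : ∀ B → 𝟙 (Q B) * inside (Γ k) B ≡ 𝟙 (Q B) * ((k + c) C k)
    k-subsets B with Q B in QB
    ... | true = cong (1 *_) (trans (subsets-of-size k B) (cong (_C k) (Q-uniform B QB)))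
    ... | false = refl

  edge : ℕ → Subset m → Subset m → Bool
  edge i A A' = Γ k A ∧ P A ∧ Γ k A' ∧ not (P A') ∧ (symDiff A A' ≡ᵇ 2 * i)

  edge-ends : ∀ i A A' → edge i A A' ≡ true → ∣ A ∣ ≡ k × J-neighbours k i A A' ≡ true
  edge-ends i A A' h with ∧-true⁻ (Γ k A) h
  ... | A∈Γ , rest with ∧-true⁻ (Γ k A') (proj₂ (∧-true⁻ (P A) rest))
  ...   | A'∈Γ , rest' = ≡ᵇ-sound A∈Γ , cong₂ _∧_ A'∈Γ (proj₂ (∧-true⁻ (not (P A')) rest'))

  edges-within : ℕ → Subset m → ℕ
  edges-within i B = ∑[ A ] ∑[ A' ] 𝟙 (edge i A A') * 𝟙 ((A ∪ A') ⊆ᵇ B)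

  -- every boundary edge of P in J_i lies in ((m - k - i) choose (c - i)) members of Γ_{k+c}
  edges-covered : ∀ i → i ≤ c →
    ((m ∸ (k + i)) C (c ∸ i)) * β k i P ≡ (∑[ B ] 𝟙 (Γ (k + c) B) * edges-within i B)
  edges-covered i i≤c = begin
    N * β k i P
      ≡⟨ cong (N *_) (countPairs≡∑ (edge i)) ⟩
    N * (∑[ A ] ∑[ A' ] 𝟙 (edge i A A'))
      ≡⟨ sym (trans (∑-cong (λ A → ∑-*ˡ N (𝟙 ∘ edge i A))) (∑-*ˡ N (λ A → ∑[ A' ] 𝟙 (edge i A A')))) ⟩
    (∑[ A ] ∑[ A' ] N * 𝟙 (edge i A A'))
      ≡⟨ ∑-cong (λ A → ∑-cong (covering A)) ⟩
    (∑[ A ] ∑[ A' ] ∑[ B ] w B * (𝟙 (edge i A A') * 𝟙 ((A ∪ A') ⊆ᵇ B)))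
      ≡⟨ sym (trans (∑-weighted-comm w (λ A B → ∑[ A' ] 𝟙 (edge i A A') * 𝟙 ((A ∪ A') ⊆ᵇ B)))
                    (∑-cong (λ A → ∑-weighted-comm w (λ A' B → 𝟙 (edge i A A') * 𝟙 ((A ∪ A') ⊆ᵇ B))))) ⟩
    (∑[ B ] w B * edges-within i B) ∎
    where
    open ≡-Reasoning
    N : ℕ
    N = (m ∸ (k + i)) C (c ∸ i)
    w : Subset m → ℕ
    w B = 𝟙 (Γ (k + c) B)
    covering : ∀ A A' → N * 𝟙 (edge i A A') ≡ (∑[ B ] w B * (𝟙 (edge i A A') * 𝟙 ((A ∪ A') ⊆ᵇ B)))
    covering A A' with edge i A A' in e
    ... | false = trans (*-zeroʳ N) (sym (∑-vanish (λ B → *-zeroʳ (w B))))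
    ... | true = begin
      N * 1
        ≡⟨ *-identityʳ N ⟩
      (m ∸ (k + i)) C (c ∸ i)
        ≡⟨ cong (λ l → (m ∸ l) C (c ∸ i)) (sym ∣U∣≡k+i) ⟩
      (m ∸ ∣ U ∣) C (c ∸ i)
        ≡⟨ sym (supersets-of-size (c ∸ i) U) ⟩
      (∑[ B ] 𝟙 ((U ⊆ᵇ B) ∧ Γ (∣ U ∣ + (c ∸ i)) B))
        ≡⟨ ∑-cong (λ B → trans (cong (λ l → 𝟙 ((U ⊆ᵇ B) ∧ Γ l B)) ∣U∣+c-i≡k+c)
                               (trans (𝟙-∧ (U ⊆ᵇ B) _) (*-comm (𝟙 (U ⊆ᵇ B)) _))) ⟩
      (∑[ B ] w B * 𝟙 (U ⊆ᵇ B))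
        ≡⟨ ∑-cong (λ B → cong (w B *_) (sym (*-identityˡ _))) ⟩
      (∑[ B ] w B * (1 * 𝟙 (U ⊆ᵇ B))) ∎
      where
      U : Subset m
      U = A ∪ A'
      ∣U∣≡k+i : ∣ U ∣ ≡ k + i
      ∣U∣≡k+i = J-adjacent-union i A A' (proj₁ (edge-ends i A A' e)) (proj₂ (edge-ends i A A' e))
      ∣U∣+c-i≡k+c : ∣ U ∣ + (c ∸ i) ≡ k + c
      ∣U∣+c-i≡k+c = trans (cong (_+ (c ∸ i)) ∣U∣≡k+i) (trans (+-assoc k i _) (cong (k +_) (m+[n∸m]≡n i≤c)))

  -- inside a (k+c)-set B, each boundary edge is charged to its end in P ...
  edges-within-inner : ∀ i B → Γ (k + c) B ≡ true → edges-within i B ≤ ((k C i) * (c C i)) * inside P B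
  edges-within-inner i B B∈Γ = begin
    edges-within i B
      ≤⟨ ∑-mono (λ A → ∑-mono (charge A)) ⟩
    (∑[ A ] ∑[ A' ] 𝟙 ((A ⊆ᵇ B) ∧ P A) * 𝟙 ((A' ⊆ᵇ B) ∧ J-neighbours k i A A'))
      ≡⟨ ∑-cong (λ A → ∑-*ˡ (𝟙 ((A ⊆ᵇ B) ∧ P A)) (λ A' → 𝟙 ((A' ⊆ᵇ B) ∧ J-neighbours k i A A'))) ⟩
    (∑[ A ] 𝟙 ((A ⊆ᵇ B) ∧ P A) * inside (J-neighbours k i A) B)
      ≡⟨ neighbour-pairs-within k c i P P-uniform B (≡ᵇ-sound B∈Γ) ⟩
    ((k C i) * (c C i)) * inside P B ∎
    where
    open ≤-Reasoning
    charge : ∀ A A' → 𝟙 (edge i A A') * 𝟙 ((A ∪ A') ⊆ᵇ B)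
                      ≤ 𝟙 ((A ⊆ᵇ B) ∧ P A) * 𝟙 ((A' ⊆ᵇ B) ∧ J-neighbours k i A A')
    charge A A' rewrite ∪-⊆ᵇ A A' B =
      edge⇒inner (Γ k A) (P A) (Γ k A') (P A') (symDiff A A' ≡ᵇ 2 * i) (A ⊆ᵇ B) (A' ⊆ᵇ B)

  -- ... or to its end in Γ_k ∖ P
  edges-within-outer : ∀ i B → Γ (k + c) B ≡ true → edges-within i B ≤ ((k C i) * (c C i)) * inside P̄ B
  edges-within-outer i B B∈Γ = begin
    edges-within i B
      ≤⟨ ∑-mono (λ A → ∑-mono (charge A)) ⟩
    (∑[ A ] ∑[ A' ] 𝟙 ((A' ⊆ᵇ B) ∧ P̄ A') * 𝟙 ((A ⊆ᵇ B) ∧ J-neighbours k i A' A))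
      ≡⟨ ∑-comm (λ A A' → 𝟙 ((A' ⊆ᵇ B) ∧ P̄ A') * 𝟙 ((A ⊆ᵇ B) ∧ J-neighbours k i A' A)) ⟩
    (∑[ A' ] ∑[ A ] 𝟙 ((A' ⊆ᵇ B) ∧ P̄ A') * 𝟙 ((A ⊆ᵇ B) ∧ J-neighbours k i A' A))
      ≡⟨ ∑-cong (λ A' → ∑-*ˡ (𝟙 ((A' ⊆ᵇ B) ∧ P̄ A')) (λ A → 𝟙 ((A ⊆ᵇ B) ∧ J-neighbours k i A' A))) ⟩
    (∑[ A' ] 𝟙 ((A' ⊆ᵇ B) ∧ P̄ A') * inside (J-neighbours k i A') B)
      ≡⟨ neighbour-pairs-within k c i P̄ P̄-uniform B (≡ᵇ-sound B∈Γ) ⟩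
    ((k C i) * (c C i)) * inside P̄ B ∎
    where
    open ≤-Reasoning
    charge : ∀ A A' → 𝟙 (edge i A A') * 𝟙 ((A ∪ A') ⊆ᵇ B)
                      ≤ 𝟙 ((A' ⊆ᵇ B) ∧ P̄ A') * 𝟙 ((A ⊆ᵇ B) ∧ J-neighbours k i A' A)
    charge A A' rewrite ∪-⊆ᵇ A A' B | symDiff-comm A' A =
      edge⇒outer (Γ k A) (P A) (Γ k A') (P A') (symDiff A A' ≡ᵇ 2 * i) (A ⊆ᵇ B) (A' ⊆ᵇ B)

  -- counting pairs (B, boundary edge of P inside B) for B ∈ Γ_{k+c}, charging each pair
  -- to Λ(P̄, Q) when B ∈ Q and to Λ(P, Q̄) when B ∉ Q
  boundary-bound : ∀ i → i ≤ c →
    ((m ∸ (k + i)) C (c ∸ i)) * β k i P ≤ ((k C i) * (c C i)) * (Λ P̄ Q + Λ P Q̄)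
  boundary-bound i i≤c = begin
    ((m ∸ (k + i)) C (c ∸ i)) * β k i P
      ≡⟨ edges-covered i i≤c ⟩
    (∑[ B ] 𝟙 (Γ (k + c) B) * edges-within i B)
      ≡⟨ ∑-Γ-split (edges-within i) ⟩
    (∑[ B ] 𝟙 (Q B) * edges-within i B) + (∑[ B ] 𝟙 (Q̄ B) * edges-within i B)
      ≤⟨ +-mono-≤ (∑-mono (λ B → 𝟙-guarded-≤ (Q B) (λ B∈Q →
                     edges-within-outer i B (≡ᵇ-complete (Q-uniform B B∈Q)))))
                  (∑-mono (λ B → 𝟙-guarded-≤ (Q̄ B) (λ B∈Q̄ →
                     edges-within-inner i B (proj₁ (∧-true⁻ (Γ (k + c) B) B∈Q̄))))) ⟩
    (∑[ B ] 𝟙 (Q B) * (N * inside P̄ B)) + (∑[ B ] 𝟙 (Q̄ B) * (N * inside P B))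
      ≡⟨ cong₂ _+_ (scaled P̄ Q) (scaled P Q̄) ⟩
    N * Λ P̄ Q + N * Λ P Q̄
      ≡⟨ sym (*-distribˡ-+ N (Λ P̄ Q) (Λ P Q̄)) ⟩
    N * (Λ P̄ Q + Λ P Q̄) ∎
    where
    open ≤-Reasoning
    N : ℕ
    N = (k C i) * (c C i)
    scaled : ∀ S T → (∑[ B ] 𝟙 (T B) * (N * inside S B)) ≡ N * Λ S T
    scaled S T = trans (∑-cong (λ B → *-exchange (𝟙 (T B)) N (inside S B)))
                       (trans (∑-*ˡ N (λ B → 𝟙 (T B) * inside S B)) (cong (N *_) (sym (Λ-as-sum S T))))

  -- when |P| = |Q| and m = 2k + c - 1, the two countings Λ-P-layer and Λ-into-Q give
  -- Λ(P̄, Q) = Λ(P, Q̄) + |P| (k+c-1 choose c-1)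
  Λ-exchange : 1 ≤ c → m ≡ k + (k + c ∸ 1) → size P ≡ size Q →
    Λ P̄ Q ≡ Λ P Q̄ + size P * ((k + c ∸ 1) C (c ∸ 1))
  Λ-exchange 1≤c m≡ |P|≡|Q| = +-cancelˡ-≡ (Λ P Q) (Λ P̄ Q) (Λ P Q̄ + size P * B₁) (begin
    Λ P Q + Λ P̄ Q
      ≡⟨ Λ-into-Q ⟩
    size Q * ((k + c) C k)
      ≡⟨ cong₂ _*_ (sym |P|≡|Q|) (layer-pascal k c 1≤c) ⟩
    size P * (B₁ + (k + c ∸ 1) C c)
      ≡⟨ *-distribˡ-+ (size P) B₁ _ ⟩
    size P * B₁ + size P * ((k + c ∸ 1) C c)
      ≡⟨ cong (λ l → size P * B₁ + size P * (l C c)) (sym m∸k≡) ⟩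
    size P * B₁ + size P * ((m ∸ k) C c)
      ≡⟨ cong (size P * B₁ +_) (sym Λ-P-layer) ⟩
    size P * B₁ + (Λ P Q + Λ P Q̄)
      ≡⟨ rotate (size P * B₁) (Λ P Q) (Λ P Q̄) ⟩
    Λ P Q + (Λ P Q̄ + size P * B₁) ∎)
    where
    open ≡-Reasoning
    B₁ : ℕ
    B₁ = (k + c ∸ 1) C (c ∸ 1)
    m∸k≡ : m ∸ k ≡ k + c ∸ 1
    m∸k≡ = trans (cong (_∸ k) m≡) (m+n∸m≡n k (k + c ∸ 1))
    rotate : ∀ a b d → a + (b + d) ≡ b + (d + a)
    rotate = solve-∀

  boundary-vs-Λ : 1 ≤ c → m ≡ k + (k + c ∸ 1) → size P ≡ size Q → ∀ i → i ≤ c →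
    ((m ∸ (k + i)) C (c ∸ i)) * β k i P
      ≤ ((k C i) * (c C i)) * (2 * Λ P Q̄ + size P * ((k + c ∸ 1) C (c ∸ 1)))
  boundary-vs-Λ 1≤c m≡ |P|≡|Q| i i≤c =
    subst (λ t → ((m ∸ (k + i)) C (c ∸ i)) * β k i P ≤ ((k C i) * (c C i)) * t) Λ-sum (boundary-bound i i≤c)
    where
    Λ-sum : Λ P̄ Q + Λ P Q̄ ≡ 2 * Λ P Q̄ + size P * ((k + c ∸ 1) C (c ∸ 1))
    Λ-sum = trans (cong (_+ Λ P Q̄) (Λ-exchange 1≤c m≡ |P|≡|Q|)) (regroup (Λ P Q̄) _)
      where
      regroup : ∀ l x → (l + x) + l ≡ 2 * l + x
      regroup = solve-∀

  β-c-bound : 1 ≤ c → m ≡ k + (k + c ∸ 1) → size P ≡ size Q →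
    β k c P ≤ 2 * (k C c) * Λ P Q̄ + (k C c) * ((k + c ∸ 1) C (c ∸ 1)) * size P
  β-c-bound 1≤c m≡ |P|≡|Q| = subst₂ _≤_ coefficient factor (boundary-vs-Λ 1≤c m≡ |P|≡|Q| c ≤-refl)
    where
    coefficient : ((m ∸ (k + c)) C (c ∸ c)) * β k c P ≡ β k c P
    coefficient = trans (cong (λ j → ((m ∸ (k + c)) C j) * β k c P) (n∸n≡0 c))
                        (trans (cong (_* β k c P) (C-zero (m ∸ (k + c)))) (*-identityˡ (β k c P)))
    factor : ((k C c) * (c C c)) * (2 * Λ P Q̄ + size P * ((k + c ∸ 1) C (c ∸ 1)))
             ≡ 2 * (k C c) * Λ P Q̄ + (k C c) * ((k + c ∸ 1) C (c ∸ 1)) * size P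
    factor = trans (cong (λ t → ((k C c) * t) * (2 * Λ P Q̄ + size P * B₁)) (nCn≡1 c)) (regroup (k C c) (Λ P Q̄) (size P) B₁)
      where
      regroup : ∀ K L s B → (K * 1) * (2 * L + s * B) ≡ 2 * K * L + K * B * s
      regroup = solve-∀
      B₁ : ℕ
      B₁ = (k + c ∸ 1) C (c ∸ 1)

  β-1-bound : 1 ≤ c → m ≡ k + (k + c ∸ 1) → size P ≡ size Q →
    ((k + c ∸ 2) C (c ∸ 1)) * β k 1 P ≤ 2 * c * k * Λ P Q̄ + c * k * ((k + c ∸ 1) C (c ∸ 1)) * size P
  β-1-bound 1≤c m≡ |P|≡|Q| = subst₂ _≤_ coefficient factor (boundary-vs-Λ 1≤c m≡ |P|≡|Q| 1 1≤c)
    where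
    coefficient : ((m ∸ (k + 1)) C (c ∸ 1)) * β k 1 P ≡ ((k + c ∸ 2) C (c ∸ 1)) * β k 1 P
    coefficient = cong (λ l → (l C (c ∸ 1)) * β k 1 P)
      (trans (cong (_∸ (k + 1)) m≡) (trans ([m+n]∸[m+o]≡n∸o k (k + c ∸ 1) 1) (∸-+-assoc (k + c) 1 1)))
    factor : ((k C 1) * (c C 1)) * (2 * Λ P Q̄ + size P * ((k + c ∸ 1) C (c ∸ 1)))
             ≡ 2 * c * k * Λ P Q̄ + c * k * ((k + c ∸ 1) C (c ∸ 1)) * size P
    factor = trans (cong₂ (λ a b → (a * b) * (2 * Λ P Q̄ + size P * B₁)) (nC1≡n k) (nC1≡n c)) (regroup k c (Λ P Q̄) (size P) B₁)
      where
      regroup : ∀ k c L s B → (k * c) * (2 * L + s * B) ≡ 2 * c * k * L + c * k * B * s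
      regroup = solve-∀
      B₁ : ℕ
      B₁ = (k + c ∸ 1) C (c ∸ 1)

card-insertAt : ∀ {m} (S : Subset m) (x : Fin (suc m)) b → ∣ insertAt S x b ∣ ≡ 𝟙 b + ∣ S ∣
card-insertAt S Fin.zero true = refl
card-insertAt S Fin.zero false = refl
card-insertAt (true ∷ S) (Fin.suc x) b = trans (cong suc (card-insertAt S x b)) (sym (+-suc (𝟙 b) ∣ S ∣))
card-insertAt (false ∷ S) (Fin.suc x) b = card-insertAt S x b

∁-insertAt : ∀ {m} (S : Subset m) (x : Fin (suc m)) b → ∁ (insertAt S x b) ≡ insertAt (∁ S) x (not b)
∁-insertAt S x b = map-insertAt not b S x

∁-involutive : ∀ {n} (S : Subset n) → ∁ (∁ S) ≡ S
∁-involutive S = trans (sym (map-∘ not not S)) (trans (map-cong not-involutive S) (map-id S))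

𝒜-uniform : ∀ {m k} {F : Family (suc m)} (x : Fin (suc m)) → Uniform k F → ∀ A → 𝒜 F x A ≡ true → ∣ A ∣ ≡ k
𝒜-uniform x uniform A A∈𝒜 = trans (sym (card-insertAt A x false)) (uniform _ A∈𝒜)

ℬ-uniform : ∀ {m k c} {F : Family (suc m)} (x : Fin (suc m)) → suc m ≡ 2 * k + c →
  ∀ B → ℬ k F x B ≡ true → ∣ B ∣ ≡ k + c
ℬ-uniform {m} {k} {c} x n≡ B B∈ℬ = +-cancelʳ-≡ k ∣ B ∣ (k + c) (begin
  ∣ B ∣ + k
    ≡⟨ cong (∣ B ∣ +_) (sym ∣T∣≡k) ⟩
  ∣ B ∣ + ∣ ∁ (insertAt B x false) ∣
    ≡⟨ cong (λ T → ∣ B ∣ + ∣ T ∣) (∁-insertAt B x false) ⟩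
  ∣ B ∣ + ∣ insertAt (∁ B) x true ∣
    ≡⟨ cong (∣ B ∣ +_) (card-insertAt (∁ B) x true) ⟩
  ∣ B ∣ + suc ∣ ∁ B ∣
    ≡⟨ cong (λ l → ∣ B ∣ + suc l) (∣∁p∣≡n∸∣p∣ B) ⟩
  ∣ B ∣ + suc (m ∸ ∣ B ∣)
    ≡⟨ trans (+-suc ∣ B ∣ _) (cong suc (m+[n∸m]≡n (∣p∣≤n B))) ⟩
  suc m
    ≡⟨ trans n≡ (complement-size k c) ⟩
  k + c + k ∎)
  where
  open ≡-Reasoning
  ∣T∣≡k : ∣ ∁ (insertAt B x false) ∣ ≡ k
  ∣T∣≡k = ≡ᵇ-sound (proj₁ (∧-true⁻ (Γ k (∁ (insertAt B x false))) (proj₁ (∧-true⁻ (Star k x (∁ (insertAt B x false))) B∈ℬ))))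
  complement-size : ∀ k c → 2 * k + c ≡ k + c + k
  complement-size = solve-∀

-- each k-set S of [m] gives the member S ∪ {x} of K_x, which lies either in F or,
-- through its complement, in ℬ
Kₓ-split : ∀ {m k} {F : Family (suc m)} (x : Fin (suc m)) → Uniform (suc k) F →
  ∀ S → 𝟙 (Γ k S) ≡ 𝟙 (F (insertAt S x true)) + 𝟙 (ℬ (suc k) F x (∁ S))
Kₓ-split {m} {k} {F} x uniform S =
  trans (𝟙-split true F⇒Γ) (cong (λ b → 𝟙 (F T) + 𝟙 b) (sym ℬ∁S≡))
  where
  T : Subset (suc m)
  T = insertAt S x true
  F⇒Γ : F T ≡ true → Γ k S ≡ true
  F⇒Γ T∈F = ≡ᵇ-complete (suc-injective (trans (sym (card-insertAt S x true)) (uniform T T∈F)))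
  ℬ∁S≡ : ℬ (suc k) F x (∁ S) ≡ Γ k S ∧ not (F T)
  ℬ∁S≡ = begin
    ℬ (suc k) F x (∁ S)
      ≡⟨ cong (λ U → Star (suc k) x U ∧ not (F U))
              (trans (∁-insertAt (∁ S) x false) (cong (λ U → insertAt U x true) (∁-involutive S))) ⟩
    ((∣ T ∣ ≡ᵇ suc k) ∧ lookup T x) ∧ not (F T)
      ≡⟨ cong₂ (λ l b → ((l ≡ᵇ suc k) ∧ b) ∧ not (F T)) (card-insertAt S x true) (insertAt-lookup S x true) ⟩
    (Γ k S ∧ true) ∧ not (F T)
      ≡⟨ cong (_∧ not (F T)) (∧-identityʳ (Γ k S)) ⟩
    Γ k S ∧ not (F T) ∎
    where open ≡-Reasoning

-- if |F| = |K_x| = (m choose k-1), then F ∖ K_x and K_x ∖ F have the same size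
𝒜-ℬ-same-size : ∀ {m k} {F : Family (suc m)} (x : Fin (suc m)) → Uniform (suc k) F → size F ≡ m C k →
  size (𝒜 F x) ≡ size (ℬ (suc k) F x)
𝒜-ℬ-same-size {m} {k} {F} x uniform |F|≡M = +-cancelˡ-≡ |F∩Kₓ| _ _ (begin
  |F∩Kₓ| + size (𝒜 F x)
    ≡⟨ cong (|F∩Kₓ| +_) (count≡∑ (𝒜 F x)) ⟩
  |F∩Kₓ| + (∑[ S ] 𝟙 (F (insertAt S x false)))
    ≡⟨ sym (trans (count≡∑ F) (∑-insertAt x (𝟙 ∘ F))) ⟩
  size F
    ≡⟨ |F|≡M ⟩
  m C k
    ≡⟨ sym k-sets ⟩
  ∑ {m} (λ S → 𝟙 (Γ k S))
    ≡⟨ ∑-cong (Kₓ-split x uniform) ⟩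
  (∑[ S ] 𝟙 (F (insertAt S x true)) + 𝟙 (ℬ (suc k) F x (∁ S)))
    ≡⟨ ∑-+ (λ S → 𝟙 (F (insertAt S x true))) (λ S → 𝟙 (ℬ (suc k) F x (∁ S))) ⟩
  |F∩Kₓ| + (∑[ S ] 𝟙 (ℬ (suc k) F x (∁ S)))
    ≡⟨ cong (|F∩Kₓ| +_) (sym (trans (count≡∑ (ℬ (suc k) F x)) (∑-∁ (𝟙 ∘ ℬ (suc k) F x)))) ⟩
  |F∩Kₓ| + size (ℬ (suc k) F x) ∎)
  where
  open ≡-Reasoning
  |F∩Kₓ| : ℕ
  |F∩Kₓ| = ∑[ S ] 𝟙 (F (insertAt S x true))
  k-sets : ∑ {m} (λ S → 𝟙 (Γ k S)) ≡ m C k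
  k-sets = trans (∑-cong {m} (λ S → cong (λ b → 𝟙 (b ∧ Γ k S)) (sym (⊆ᵇ-⊤ S))))
                 (trans (subsets-of-size k (⊤ {m})) (cong (_C k) (∣⊤∣≡n m)))

ground-set-size : ∀ {m} k c → 1 ≤ c → suc m ≡ 2 * k + c → m ≡ k + (k + c ∸ 1)
ground-set-size {m} k c 1≤c n≡ = suc-injective (begin
  suc m                 ≡⟨ n≡ ⟩
  2 * k + c             ≡⟨ regroup k c ⟩
  k + (k + c)           ≡⟨ cong (k +_) (sym (m+[n∸m]≡n (≤-trans 1≤c (m≤n+m c k)))) ⟩
  k + suc (k + c ∸ 1)   ≡⟨ +-suc k (k + c ∸ 1) ⟩
  suc (k + (k + c ∸ 1)) ∎)
  where
  open ≡-Reasoning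
  regroup : ∀ k c → 2 * k + c ≡ k + (k + c)
  regroup = solve-∀

proposition2p3 : (k c m : ℕ) → 1 ≤ c → 6 * c < k → suc m ≡ 2 * k + c →
    (F : Family (suc m)) → InC (suc m) k F →
    (x : Fin (suc m)) → MaxDegree F x →
    (β k c (𝒜 F x) ≤ 2 * (k C c) * Λ (𝒜 F x) (ℬ̄ k c F x) + (k C c) * ((k + c ∸ 1) C (c ∸ 1)) * size (𝒜 F x))
    × (((k + c ∸ 2) C (c ∸ 1)) * β k 1 (𝒜 F x) ≤ 2 * c * k * Λ (𝒜 F x) (ℬ̄ k c F x) + c * k * ((k + c ∸ 1) C (c ∸ 1)) * size (𝒜 F x))
proposition2p3 zero _ _ _ () _ _ _ _ _
proposition2p3 k@(suc _) c m 1≤c _ n≡ F (uniform , |F|≡M , _) x _ =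
  β-c-bound 1≤c m≡ |𝒜|≡|ℬ| , β-1-bound 1≤c m≡ |𝒜|≡|ℬ|
  where
  open DoubleCounting k c (𝒜 F x) (ℬ k F x) (𝒜-uniform x uniform) (ℬ-uniform {F = F} x n≡)
  m≡ : m ≡ k + (k + c ∸ 1)
  m≡ = ground-set-size k c 1≤c n≡
  |𝒜|≡|ℬ| : size (𝒜 F x) ≡ size (ℬ k F x)
  |𝒜|≡|ℬ| = 𝒜-ℬ-same-size x uniform |F|≡M
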